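{- Let $f_0:\{1,2,\dots\}\to\mathbb{C}$ be an arithmetic function, with iterated invert transforms $f_m$ and numbers $c_m(n,k)$ as in the context. For all integers $m\ge1$ and $n\ge1$, \[ f_m(n)=\sum_{i=1}^{n}m^{i-1}c_1(n,i). \]
   Context: For $m\ge1$, $f_m$ is the $m$th invert transform of $f_0$, defined recursively by $f_m(0)=1$ and $f_m(n)=\sum_{i=1}^{n} f_{m-1}(i)\,f_m(n-i)$ for $n\ge1$; equivalently, $1+\sum_{n\ge1}f_m(n)x^n=\bigl(1-\sum_{n\ge1}f_{m-1}(n)x^n\bigr)^{ -1}$. For integers $m\ge1$ and $0\le k\le n$, $c_m(n,k)$ is defined by $c_m(0,0)=1$, $c_m(n,0)=0$ for $n\ge1$, and $c_m(n,k)=\sum_{i=1}^{n-k+1} f_{m-1}(i)\,c_m(n-i,k-1)$ for $1\le k\le n$; in particular $c_1(n,k)=\sum_{i=1}^{n-k+1} f_{0}(i)\,c_1(n-i,k-1)$. -}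

module Defs where

open import Level using (Level)
open import Data.Nat using (ℕ; zero; suc; _∸_)
open import Data.Vec using (Vec; []; _∷_; head)
open import Algebra.Bundles using (CommutativeRing; Semiring)
import Algebra.Definitions.RawSemiring as RS

module _ {a ℓ : Level} (R : CommutativeRing a ℓ) where
  open CommutativeRing R
  open RS (Semiring.rawSemiring semiring) using (_×_; _^_)

  sum1 : ℕ → (ℕ → Carrier) → Carrier
  sum1 zero    g = 0#
  sum1 (suc n) g = sum1 n g + g (suc n)

  -- Given g and the reversed table [v_n, v_{n-1}, …, v_0] of length len,
  -- compute Σ_{i=1}^{len} g(i) * v_{n+1-i}  (the i-th entry is v_{n+1-i}).
  convStep : (ℕ → Carrier) → ℕ → {len : ℕ} → Vec Carrier len → Carrier
  convStep g i []       = 0#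
  convStep g i (v ∷ vs) = g i * v + convStep g (suc i) vs

  -- reversed table of the invert transform of g: [h(n), h(n-1), …, h(0)]
  invTab : (ℕ → Carrier) → (n : ℕ) → Vec Carrier (suc n)
  invTab g zero    = 1# ∷ []
  invTab g (suc n) = convStep g 1 (invTab g n) ∷ invTab g n

  -- invert transform: invert g 0 = 1, invert g n = Σ_{i=1}^{n} g(i) invert g (n-i)
  invert : (ℕ → Carrier) → ℕ → Carrier
  invert g n = head (invTab g n)

  -- f m n : the m-th invert transform of f0 (f 0 = f0; only values at n ≥ 1 of f0 matter)
  f : (ℕ → Carrier) → ℕ → ℕ → Carrier
  f f0 zero    = f0
  f f0 (suc m) = invert (f f0 m)

  cg : (ℕ → Carrier) → ℕ → ℕ → Carrier
  cg g zero    zero    = 1#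
  cg g (suc n) zero    = 0#
  cg g n       (suc k) = sum1 (n ∸ k) (λ i → g i * cg g (n ∸ i) k)

  c : (ℕ → Carrier) → ℕ → ℕ → ℕ → Carrier
  c f0 m n k = cg (f f0 (m ∸ 1)) n k

  natPow : ℕ → ℕ → Carrier
  natPow m e = (m × 1#) ^ e

-- Read sequences as formal power series and put φ = Σ_{n≥1} f₀(n) xⁿ. If the positive part G
-- of a series is φ/(1 − sφ), the positive part G/(1 − G) of its invert transform is
-- φ/(1 − (s+1)φ); so the positive part of f_m is φ/(1 − mφ). On the other side c₁(·,k) are the
-- coefficients of φᵏ, and Σ_{k≥1} m^{k−1} φᵏ = φ/(1 − mφ) as well. Both series solve
-- X = φ + m·φX, and that equation determines X coefficientwise because φ(0) = 0.
module Submission where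

open import Defs
open import Level using (Level)
open import Data.Nat as ℕ using (ℕ; zero; suc; _∸_; _≥_; _≤_; _<_; z≤n; s≤s)
open import Data.Nat.Properties
  using (≤-refl; m≤n⇒m≤1+n; m≤n⇒m<n∨m≡n; m∸n≤m; m≤n⇒m∸n≡0; m∸[m∸n]≡n;
         ∸-monoʳ-≤; <⇒≱; ≰⇒>)
import Data.Nat.Properties as ℕₚ
open import Data.Nat.Induction using (<-rec)
open import Data.Sum using (inj₁; inj₂)
open import Algebra.Bundles using (CommutativeRing; Semiring)
import Algebra.Definitions.RawSemiring as RawSemiring
import Algebra.Properties.CommutativeSemigroup as CommutativeSemigroupProperties
open import Relation.Binary.PropositionalEquality as ≡ using (_≡_)

∸-<-swap : ∀ {n i k} → i ≤ n → n ∸ k < i → n ∸ i < k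
∸-<-swap {n} {i} {k} i≤n n∸k<i = ≰⇒> λ k≤n∸i →
  <⇒≱ n∸k<i (≡.subst (_≤ n ∸ k) (m∸[m∸n]≡n i≤n) (∸-monoʳ-≤ n k≤n∸i))

module _ {a ℓ : Level} (R : CommutativeRing a ℓ) where
  open CommutativeRing R
  open RawSemiring (Semiring.rawSemiring semiring) using (_×_)
  open CommutativeSemigroupProperties +-commutativeSemigroup using (interchange)
  open CommutativeSemigroupProperties *-commutativeSemigroup using (x∙yz≈y∙xz)
  open import Relation.Binary.Reasoning.Setoid setoid

  sum1-cong : ∀ N {h h' : ℕ → Carrier} → (∀ i → h (suc i) ≈ h' (suc i)) →
              sum1 R N h ≈ sum1 R N h'
  sum1-cong zero    e = refl
  sum1-cong (suc N) e = +-cong (sum1-cong N e) (e N)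

  sum1-unfoldˡ : ∀ N (h : ℕ → Carrier) → sum1 R (suc N) h ≈ h 1 + sum1 R N (λ i → h (suc i))
  sum1-unfoldˡ zero    h = +-comm 0# (h 1)
  sum1-unfoldˡ (suc N) h = trans (+-congʳ (sum1-unfoldˡ N h)) (+-assoc _ _ _)

  sum1-*-distribˡ : ∀ N s (h : ℕ → Carrier) → s * sum1 R N h ≈ sum1 R N (λ i → s * h i)
  sum1-*-distribˡ zero    s h = zeroʳ s
  sum1-*-distribˡ (suc N) s h = trans (distribˡ s _ _) (+-congʳ (sum1-*-distribˡ N s h))

  sum1-extend : ∀ {N M} (h : ℕ → Carrier) → N ≤ M → (∀ i → N < i → i ≤ M → h i ≈ 0#) →
                sum1 R N h ≈ sum1 R M h
  sum1-extend {M = zero}  h z≤n vanish = refl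
  sum1-extend {N} {suc M} h N≤1+M vanish with m≤n⇒m<n∨m≡n N≤1+M
  ... | inj₂ ≡.refl      = refl
  ... | inj₁ (s≤s N≤M) = begin
    sum1 R N h               ≈⟨ sum1-extend h N≤M (λ i N<i i≤M → vanish i N<i (m≤n⇒m≤1+n i≤M)) ⟩
    sum1 R M h               ≈⟨ +-identityʳ _ ⟨
    sum1 R M h + 0#          ≈⟨ +-congˡ (vanish (suc M) (s≤s N≤M) ≤-refl) ⟨
    sum1 R M h + h (suc M)   ∎

  ≈0⇒*-const : ∀ {x y z} → x ≈ 0# → x * y ≈ x * z
  ≈0⇒*-const {x} {y} {z} x≈0 = begin
    x * y    ≈⟨ *-congʳ x≈0 ⟩
    0# * y   ≈⟨ zeroˡ y ⟩
    0#       ≈⟨ zeroˡ z ⟨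
    0# * z   ≈⟨ *-congʳ x≈0 ⟨
    x * z    ∎

  Series : Set a
  Series = ℕ → Carrier

  δ : Series
  δ zero    = 1#
  δ (suc n) = 0#

  shift : Series → Series
  shift b n = b (suc n)

  delay : Series → Series
  delay b zero    = 0#
  delay b (suc n) = b n

  positive : Series → Series
  positive b = delay (shift b)

  -- The Cauchy product, recursing on the first factor so that no truncated subtraction occurs.
  infixl 7 _⋆_
  _⋆_ : Series → Series → Series
  (b ⋆ c) zero    = b 0 * c 0
  (b ⋆ c) (suc n) = b 0 * c (suc n) + (shift b ⋆ c) n

  ⋆-congˡ : ∀ n {b b' : Series} (c : Series) → (∀ t → b t ≈ b' t) → (b ⋆ c) n ≈ (b' ⋆ c) n
  ⋆-congˡ zero    c e = *-congʳ (e 0)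
  ⋆-congˡ (suc n) c e = +-cong (*-congʳ (e 0)) (⋆-congˡ n c (λ t → e (suc t)))

  ⋆-congʳ : ∀ n (b : Series) {c c' : Series} → (∀ j → j ≤ n → c j ≈ c' j) →
            (b ⋆ c) n ≈ (b ⋆ c') n
  ⋆-congʳ zero    b e = *-congˡ (e 0 z≤n)
  ⋆-congʳ (suc n) b e =
    +-cong (*-congˡ (e (suc n) ≤-refl)) (⋆-congʳ n (shift b) (λ j j≤n → e j (m≤n⇒m≤1+n j≤n)))

  ⋆-congʳ-strict : ∀ n (b : Series) {c c' : Series} → b 0 ≈ 0# →
                   (∀ {j} → j < n → c j ≈ c' j) → (b ⋆ c) n ≈ (b ⋆ c') n
  ⋆-congʳ-strict zero    b b₀≈0 below = ≈0⇒*-const b₀≈0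
  ⋆-congʳ-strict (suc n) b b₀≈0 below =
    +-cong (≈0⇒*-const b₀≈0) (⋆-congʳ n (shift b) (λ j j≤n → below (s≤s j≤n)))

  ⋆-distribʳ-+ : ∀ n (b b' c : Series) → ((λ t → b t + b' t) ⋆ c) n ≈ (b ⋆ c) n + (b' ⋆ c) n
  ⋆-distribʳ-+ zero    b b' c = distribʳ _ _ _
  ⋆-distribʳ-+ (suc n) b b' c =
    trans (+-cong (distribʳ _ _ _) (⋆-distribʳ-+ n (shift b) (shift b') c)) (interchange _ _ _ _)

  ⋆-distribˡ-+ : ∀ n (b c c' : Series) → (b ⋆ (λ t → c t + c' t)) n ≈ (b ⋆ c) n + (b ⋆ c') n
  ⋆-distribˡ-+ zero    b c c' = distribˡ _ _ _
  ⋆-distribˡ-+ (suc n) b c c' =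
    trans (+-cong (distribˡ _ _ _) (⋆-distribˡ-+ n (shift b) c c')) (interchange _ _ _ _)

  *-⋆-assoc : ∀ n s (b c : Series) → ((λ t → s * b t) ⋆ c) n ≈ s * (b ⋆ c) n
  *-⋆-assoc zero    s b c = *-assoc _ _ _
  *-⋆-assoc (suc n) s b c =
    trans (+-cong (*-assoc _ _ _) (*-⋆-assoc n s (shift b) c)) (sym (distribˡ _ _ _))

  ⋆-*-comm : ∀ n s (b c : Series) → (b ⋆ (λ t → s * c t)) n ≈ s * (b ⋆ c) n
  ⋆-*-comm zero    s b c = x∙yz≈y∙xz _ _ _
  ⋆-*-comm (suc n) s b c =
    trans (+-cong (x∙yz≈y∙xz _ _ _) (⋆-*-comm n s (shift b) c)) (sym (distribˡ _ _ _))

  ⋆-zeroʳ : ∀ n (b : Series) → (b ⋆ (λ _ → 0#)) n ≈ 0#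
  ⋆-zeroʳ zero    b = zeroʳ _
  ⋆-zeroʳ (suc n) b = trans (+-cong (zeroʳ _) (⋆-zeroʳ n (shift b))) (+-identityˡ 0#)

  ⋆-identityʳ : ∀ n (b : Series) → (b ⋆ δ) n ≈ b n
  ⋆-identityʳ zero    b = *-identityʳ _
  ⋆-identityʳ (suc n) b = trans (+-cong (zeroʳ _) (⋆-identityʳ n (shift b))) (+-identityˡ _)

  ⋆-sum1ʳ : ∀ N n (b : Series) (c : ℕ → Series) →
            (b ⋆ (λ j → sum1 R N (λ k → c k j))) n ≈ sum1 R N (λ k → (b ⋆ c k) n)
  ⋆-sum1ʳ zero    n b c = ⋆-zeroʳ n b
  ⋆-sum1ʳ (suc N) n b c = trans (⋆-distribˡ-+ n b _ _) (+-congʳ (⋆-sum1ʳ N n b c))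

  ⋆-unfoldˡ : ∀ (b c : Series) t → (b ⋆ c) t ≈ b 0 * c t + delay (shift b ⋆ c) t
  ⋆-unfoldˡ b c zero    = sym (+-identityʳ _)
  ⋆-unfoldˡ b c (suc t) = refl

  delay-⋆ : ∀ n (b c : Series) → (delay b ⋆ c) (suc n) ≈ (b ⋆ c) n
  delay-⋆ n b c = trans (+-congʳ (zeroˡ _)) (+-identityˡ _)

  ⋆-assoc : ∀ n (b c d : Series) → ((b ⋆ c) ⋆ d) n ≈ (b ⋆ (c ⋆ d)) n
  ⋆-assoc zero    b c d = *-assoc _ _ _
  ⋆-assoc (suc n) b c d = begin
    ((b ⋆ c) ⋆ d) (suc n)
      ≈⟨ ⋆-congˡ (suc n) d (⋆-unfoldˡ b c) ⟩
    ((λ t → b 0 * c t + delay (shift b ⋆ c) t) ⋆ d) (suc n)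
      ≈⟨ ⋆-distribʳ-+ (suc n) (λ t → b 0 * c t) (delay (shift b ⋆ c)) d ⟩
    ((λ t → b 0 * c t) ⋆ d) (suc n) + (delay (shift b ⋆ c) ⋆ d) (suc n)
      ≈⟨ +-cong (*-⋆-assoc (suc n) (b 0) c d) (delay-⋆ n _ d) ⟩
    b 0 * (c ⋆ d) (suc n) + ((shift b ⋆ c) ⋆ d) n
      ≈⟨ +-congˡ (⋆-assoc n (shift b) c d) ⟩
    b 0 * (c ⋆ d) (suc n) + (shift b ⋆ (c ⋆ d)) n ∎

  ⋆≈sum1 : ∀ n (b c : Series) → (b ⋆ c) n ≈ b 0 * c n + sum1 R n (λ i → b i * c (n ∸ i))
  ⋆≈sum1 zero    b c = sym (+-identityʳ _)
  ⋆≈sum1 (suc n) b c = +-congˡ (begin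
    (shift b ⋆ c) n
      ≈⟨ ⋆≈sum1 n (shift b) c ⟩
    b 1 * c n + sum1 R n (λ i → b (suc i) * c (n ∸ i))
      ≈⟨ sum1-unfoldˡ n (λ i → b i * c (suc n ∸ i)) ⟨
    sum1 R (suc n) (λ i → b i * c (suc n ∸ i)) ∎)

  positive-⋆ : ∀ n (b c : Series) → (positive b ⋆ c) n ≈ sum1 R n (λ i → b i * c (n ∸ i))
  positive-⋆ n b c = trans (⋆≈sum1 n (positive b) c)
    (trans (+-congʳ (zeroˡ _)) (trans (+-identityˡ _) (sum1-cong n (λ _ → refl))))

  invert-convStep : ∀ (g : Series) n j →
                    convStep R g j (invTab R g n) ≈ ((λ t → g (t ℕ.+ j)) ⋆ invert R g) n
  invert-convStep g zero    j = +-identityʳ _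
  invert-convStep g (suc n) j = +-congˡ (begin
    convStep R g (suc j) (invTab R g n)
      ≈⟨ invert-convStep g n (suc j) ⟩
    ((λ t → g (t ℕ.+ suc j)) ⋆ invert R g) n
      ≈⟨ ⋆-congˡ n _ (λ t → reflexive (≡.cong g (ℕₚ.+-suc t j))) ⟩
    ((λ t → g (suc t ℕ.+ j)) ⋆ invert R g) n ∎)

  invert-suc : ∀ (g : Series) n → invert R g (suc n) ≈ (shift g ⋆ invert R g) n
  invert-suc g n =
    trans (invert-convStep g n 1) (⋆-congˡ n _ (λ t → reflexive (≡.cong g (ℕₚ.+-comm t 1))))

  positive-invert : ∀ (g : Series) n → positive (invert R g) n ≈ (positive g ⋆ invert R g) n
  positive-invert g zero    = sym (zeroˡ _)
  positive-invert g (suc n) = trans (invert-suc g n) (sym (delay-⋆ n (shift g) (invert R g)))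

  ⋆-invert : ∀ n (b g : Series) → (b ⋆ invert R g) n ≈ b n + (b ⋆ positive (invert R g)) n
  ⋆-invert n b g = begin
    (b ⋆ invert R g) n                                ≈⟨ ⋆-congʳ n b (λ j _ → δ+positive j) ⟩
    (b ⋆ (λ t → δ t + positive (invert R g) t)) n     ≈⟨ ⋆-distribˡ-+ n b δ _ ⟩
    (b ⋆ δ) n + (b ⋆ positive (invert R g)) n         ≈⟨ +-congʳ (⋆-identityʳ n b) ⟩
    b n + (b ⋆ positive (invert R g)) n               ∎
    where
    δ+positive : ∀ j → invert R g j ≈ δ j + positive (invert R g) j
    δ+positive zero    = sym (+-identityʳ _)
    δ+positive (suc j) = sym (+-identityˡ _)

  -- X = F + s·(F ⋆ X) says X = F/(1 − sF) as formal power series.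
  Solves : Series → Carrier → Series → Set ℓ
  Solves F s X = ∀ n → X n ≈ F n + s * (F ⋆ X) n

  Solves-unique : ∀ {F s X Y} → F 0 ≈ 0# → Solves F s X → Solves F s Y → ∀ n → X n ≈ Y n
  Solves-unique {F} {s} {X} {Y} F₀≈0 solX solY = <-rec (λ n → X n ≈ Y n) λ n X≈Y-below → begin
    X n                    ≈⟨ solX n ⟩
    F n + s * (F ⋆ X) n    ≈⟨ +-congˡ (*-congˡ (⋆-congʳ-strict n F F₀≈0 X≈Y-below)) ⟩
    F n + s * (F ⋆ Y) n    ≈⟨ solY n ⟨
    Y n                    ∎

  Solves-invert : ∀ {F s} (g : Series) →
                  Solves F s (positive g) → Solves F (1# + s) (positive (invert R g))
  Solves-invert {F} {s} g sol n = begin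
    H⁺ n
      ≈⟨ positive-invert g n ⟩
    (positive g ⋆ H) n
      ≈⟨ ⋆-congˡ n H sol ⟩
    ((λ t → F t + s * (F ⋆ positive g) t) ⋆ H) n
      ≈⟨ ⋆-distribʳ-+ n F _ H ⟩
    (F ⋆ H) n + ((λ t → s * (F ⋆ positive g) t) ⋆ H) n
      ≈⟨ +-congˡ (*-⋆-assoc n s _ H) ⟩
    (F ⋆ H) n + s * ((F ⋆ positive g) ⋆ H) n
      ≈⟨ +-congˡ (*-congˡ (⋆-assoc n F _ H)) ⟩
    (F ⋆ H) n + s * (F ⋆ (positive g ⋆ H)) n
      ≈⟨ +-congˡ (*-congˡ (⋆-congʳ n F (λ j _ → positive-invert g j))) ⟨
    (F ⋆ H) n + s * (F ⋆ H⁺) n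
      ≈⟨ +-congʳ (⋆-invert n F g) ⟩
    (F n + (F ⋆ H⁺) n) + s * (F ⋆ H⁺) n
      ≈⟨ +-assoc _ _ _ ⟩
    F n + ((F ⋆ H⁺) n + s * (F ⋆ H⁺) n)
      ≈⟨ +-congˡ (+-congʳ (*-identityˡ _)) ⟨
    F n + (1# * (F ⋆ H⁺) n + s * (F ⋆ H⁺) n)
      ≈⟨ +-congˡ (distribʳ _ 1# s) ⟨
    F n + (1# + s) * (F ⋆ H⁺) n ∎
    where
    H H⁺ : Series
    H  = invert R g
    H⁺ = positive H

  Solves-iterate : ∀ (f0 : Series) m → Solves (positive f0) (m × 1#) (positive (f R f0 m))
  Solves-iterate f0 zero    n = sym (trans (+-congˡ (zeroˡ _)) (+-identityʳ _))
  Solves-iterate f0 (suc m)   = Solves-invert (f R f0 m) (Solves-iterate f0 m)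

  power : Series → ℕ → Series
  power g k n = cg R g n k

  power-unfold : ∀ (g : Series) k n →
                 power g (suc k) n ≡ sum1 R (n ∸ k) (λ i → g i * power g k (n ∸ i))
  power-unfold g k zero    = ≡.refl
  power-unfold g k (suc n) = ≡.refl

  power-zero : ∀ (g : Series) n → power g 0 n ≈ δ n
  power-zero g zero    = refl
  power-zero g (suc n) = refl

  power-vanish : ∀ (g : Series) {n k} → n < k → power g k n ≈ 0#
  power-vanish g {n} {suc k} (s≤s n≤k) = begin
    power g (suc k) n                                  ≡⟨ power-unfold g k n ⟩
    sum1 R (n ∸ k) h                                   ≡⟨ ≡.cong (λ N → sum1 R N h) (m≤n⇒m∸n≡0 n≤k) ⟩
    0#                                                 ∎
    where
    h : ℕ → Carrier
    h i = g i * power g k (n ∸ i)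

  power-suc : ∀ (g : Series) k n → power g (suc k) n ≈ (positive g ⋆ power g k) n
  power-suc g k n = begin
    power g (suc k) n                                  ≡⟨ power-unfold g k n ⟩
    sum1 R (n ∸ k) (λ i → g i * power g k (n ∸ i))     ≈⟨ sum1-extend _ (m∸n≤m n k) vanish ⟩
    sum1 R n (λ i → g i * power g k (n ∸ i))           ≈⟨ positive-⋆ n g (power g k) ⟨
    (positive g ⋆ power g k) n                         ∎
    where
    vanish : ∀ i → n ∸ k < i → i ≤ n → g i * power g k (n ∸ i) ≈ 0#
    vanish i n∸k<i i≤n = trans (*-congˡ (power-vanish g (∸-<-swap i≤n n∸k<i))) (zeroʳ _)

  power-one : ∀ (g : Series) n → power g 1 n ≈ positive g n
  power-one g n = begin
    power g 1 n                  ≈⟨ power-suc g 0 n ⟩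
    (positive g ⋆ power g 0) n   ≈⟨ ⋆-congʳ n (positive g) (λ j _ → power-zero g j) ⟩
    (positive g ⋆ δ) n           ≈⟨ ⋆-identityʳ n (positive g) ⟩
    positive g n                 ∎

  weightedPowerSum : ℕ → Series → ℕ → Series
  weightedPowerSum m g N j = sum1 R N (λ k → natPow R m (k ∸ 1) * power g k j)

  weightedPowerSum-suc : ∀ m (g : Series) N j →
    weightedPowerSum m g (suc N) j
      ≈ positive g j + (m × 1#) * (positive g ⋆ weightedPowerSum m g N) j
  weightedPowerSum-suc m g N j = begin
    sum1 R (suc N) (λ k → w k * power g k j)
      ≈⟨ sum1-unfoldˡ N (λ k → w k * power g k j) ⟩
    1# * power g 1 j + sum1 R N (λ k → w (suc k) * power g (suc k) j)
      -- w (2 + k) unfolds to s * w (1 + k)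
      ≈⟨ +-cong (trans (*-identityˡ _) (power-one g j)) (sum1-cong N (λ k → *-assoc s _ _)) ⟩
    positive g j + sum1 R N (λ k → s * (w k * power g (suc k) j))
      ≈⟨ +-congˡ (sum1-*-distribˡ N s _) ⟨
    positive g j + s * sum1 R N (λ k → w k * power g (suc k) j)
      ≈⟨ +-congˡ (*-congˡ (sum1-cong N (λ k → *-congˡ (power-suc g (suc k) j)))) ⟩
    positive g j + s * sum1 R N (λ k → w k * (positive g ⋆ power g k) j)
      ≈⟨ +-congˡ (*-congˡ (sum1-cong N (λ k → ⋆-*-comm j (w (suc k)) _ (power g (suc k))))) ⟨
    positive g j + s * sum1 R N (λ k → (positive g ⋆ (λ t → w k * power g k t)) j)
      ≈⟨ +-congˡ (*-congˡ (⋆-sum1ʳ N j (positive g) (λ k t → w k * power g k t))) ⟨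
    positive g j + s * (positive g ⋆ weightedPowerSum m g N) j
      ∎
    where
    s : Carrier
    s = m × 1#
    w : ℕ → Carrier
    w k = natPow R m (k ∸ 1)

  weightedPowerSum-stable : ∀ m (g : Series) {N j} → j ≤ N →
                            weightedPowerSum m g j j ≈ weightedPowerSum m g N j
  weightedPowerSum-stable m g j≤N =
    sum1-extend _ j≤N (λ k j<k _ → trans (*-congˡ (power-vanish g j<k)) (zeroʳ _))

  Solves-weightedPowerSum : ∀ m (g : Series) →
                            Solves (positive g) (m × 1#) (λ n → weightedPowerSum m g n n)
  Solves-weightedPowerSum m g zero    =
    sym (trans (+-congˡ (trans (*-congˡ (zeroˡ _)) (zeroʳ _))) (+-identityʳ _))
  Solves-weightedPowerSum m g (suc n) = trans (weightedPowerSum-suc m g n (suc n))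
    (+-congˡ (*-congˡ (⋆-congʳ-strict (suc n) (positive g) refl diagonal≈below)))
    where
    diagonal≈below : ∀ {j} → j < suc n → weightedPowerSum m g n j ≈ weightedPowerSum m g j j
    diagonal≈below j<1+n = sym (weightedPowerSum-stable m g (ℕₚ.m<1+n⇒m≤n j<1+n))

proposition10 : {a ℓ : Level} (R : CommutativeRing a ℓ) →
    (f0 : ℕ → CommutativeRing.Carrier R) → (m n : ℕ) → m ≥ 1 → n ≥ 1 →
    CommutativeRing._≈_ R (f R f0 m n)
      (sum1 R n (λ i → CommutativeRing._*_ R (natPow R m (i ∸ 1)) (c R f0 1 n i)))
proposition10 R f0 m (suc n) _ _ =
  Solves-unique R (CommutativeRing.refl R)
    (Solves-iterate R f0 m) (Solves-weightedPowerSum R m f0) (suc n)
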